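{- Let $m\geq2$ be an integer. (a) Let $p\in D_{2/m}$ with $p>m$. If $f_{2/m}(p)<(m+2)p-2$, then there is $t\in T(m)$ with $p=1+tm$; in particular $p+2$ is prime. (b) If $T(m)$ is finite, then with $\lambda=\frac2m$ there is $P$ such that $\frac{f_\lambda(p)}{p}\geq m+2-\frac2p$ for all $p\in D_\lambda$ with $p>P$. (c) $T(2)=\{1\}$, and $T(m)=\emptyset$ if $m>2$ and $m\not\equiv1\pmod 3$.
   Context: For an integer $m\geq2$, $T(m)$ is the set of positive integers $t$ such that $1+tm$, $3+tm$ and $1+t(m+2)$ are all prime. For a prime $p$ and real $\lambda>0$, $I_\lambda(p)=[p,p+\lambda p]$; $D_\lambda$ is the set of primes $p$ such that $I_\lambda(p)$ contains at least two primes; for $p\in D_\lambda$, $f_\lambda(p)$ is the largest integer that is not a finite sum of primes from $I_\lambda(p)$ (the Frobenius number of the numerical semigroup generated by these primes). -}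

module Defs where

open import Data.Nat using (ℕ; zero; suc; _+_; _*_; _≤_; _<_)
open import Data.Nat.Primality using (Prime)
open import Data.List using (List)
open import Data.Nat.ListAction using (sum)
open import Data.List.Relation.Unary.All using (All)
open import Data.Product using (_×_; Σ; ∃; ∃-syntax)
open import Relation.Binary.PropositionalEquality using (_≡_; _≢_)
open import Relation.Nullary using (¬_)

InT : ℕ → ℕ → Set
InT m t = (1 ≤ t) × Prime (1 + t * m) × Prime (3 + t * m) × Prime (1 + t * (m + 2))

-- λ = a / b (b > 0 in uses).  q ∈ I_λ(p) = [p, p + λ p] and q prime:
--   p ≤ q  and  q ≤ p + (a/b) p  ⇔  b q ≤ b p + a p.
InI : (a b : ℕ) → ℕ → ℕ → Set
InI a b p q = Prime q × (p ≤ q) × (b * q ≤ b * p + a * p)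

InD : (a b : ℕ) → ℕ → Set
InD a b p = Prime p × ∃[ q ] ∃[ r ] (q ≢ r × InI a b p q × InI a b p r)

Representable : (a b : ℕ) → ℕ → ℕ → Set
Representable a b p n = ∃[ xs ] (All (InI a b p) xs × sum xs ≡ n)

IsFrobenius : (a b : ℕ) → ℕ → ℕ → Set
IsFrobenius a b p F = ¬ Representable a b p F × (∀ n → F < n → Representable a b p n)

module Submission where

-- Let p > m be prime (hence odd) and
-- suppose f_λ(p) + 2 < (m + 2)p, so that both (m + 2)p - 2 and (m + 2)p + 2
-- are sums of primes from I_λ(p).  Every such prime is odd, so it is
-- p + 2e with an "excess" e satisfying m e ≤ p, and a sum of k of them is
-- k p + 2 S where S is the total excess, with m S ≤ k p.  Comparing with the
-- two targets pins down k by size and parity: (m + 2)p + 2 needs k = m + 2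
-- and S = 1, so p + 2 is one of the summands, hence prime; (m + 2)p - 2 needs
-- k = m and S = p - 1, so the largest excess t satisfies p - 1 ≤ m t ≤ p.
-- Since m t = p is excluded by primality, p = 1 + t m, and then the three
-- numbers 1 + t m = p, 3 + t m = p + 2 and 1 + t(m + 2) = p + 2t are prime.
-- Part (b) follows since p = 1 + t m with t ∈ T(m) is impossible once p is
-- large, and part (c) is a computation modulo 3.

open import Defs
open import Data.Nat
open import Data.Nat.Properties
open import Data.Nat.Divisibility using (_∣_; divides; m∣m*n)
open import Data.Nat.DivMod using ([m+kn]%n≡m%n)
open import Data.Nat.Primality using (Prime; prime?; prime⇒irreducible; ¬prime[1])
open import Data.Nat.ListAction using (sum)
open import Data.Nat.Tactic.RingSolver using (solve-∀)
open import Data.List using (List; []; _∷_; length)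
open import Data.List.Extrema.Nat using (max; argmax-all; xs≤max)
open import Data.List.Membership.Propositional using (_∈_)
open import Data.List.Relation.Unary.All as All using (All; []; _∷_)
open import Data.List.Relation.Unary.Any using (here; there)
open import Data.Product using (_×_; _,_; proj₁; ∃-syntax)
open import Data.Sum using (_⊎_; inj₁; inj₂)
open import Data.Empty using (⊥; ⊥-elim)
open import Function using (id)
open import Relation.Nullary using (¬_; contradiction)
open import Relation.Nullary.Decidable using (from-yes)
open import Relation.Binary.PropositionalEquality

Odd : ℕ → Set
Odd n = ∃[ h ] n ≡ 1 + 2 * h

evenOrOdd : ∀ n → ∃[ h ] (n ≡ 2 * h ⊎ n ≡ 1 + 2 * h)
evenOrOdd zero = 0 , inj₁ refl
evenOrOdd (suc n) with evenOrOdd n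
... | h , inj₁ refl = h , inj₂ refl
... | h , inj₂ refl = suc h , inj₁ (sym (*-suc 2 h))

noProperDivisor : ∀ {p d} → Prime p → 1 < d → d < p → ¬ d ∣ p
noProperDivisor pr 1<d d<p d∣p with prime⇒irreducible pr d∣p
... | inj₁ d≡1 = <⇒≢ 1<d (sym d≡1)
... | inj₂ d≡p = <⇒≢ d<p d≡p

oddPrime : ∀ {q} → Prime q → 2 < q → Odd q
oddPrime {q} pr 2<q with evenOrOdd q
... | h , inj₂ q≡ = h , q≡
... | h , inj₁ refl = ⊥-elim (noProperDivisor pr (s≤s (s≤s z≤n)) 2<q (m∣m*n h))

oddGap : ∀ {p q} → Odd p → Odd q → p ≤ q → ∃[ e ] q ≡ p + 2 * e
oddGap (h , refl) (h′ , refl) p≤q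
  with m≤n⇒∃[o]m+o≡n (*-cancelˡ-≤ {h} {h′} 2 (s≤s⁻¹ p≤q))
... | e , refl = e , cong suc (*-distribˡ-+ 2 h e)

sum≤length*bound : ∀ {u} {es : List ℕ} → All (_≤ u) es → sum es ≤ length es * u
sum≤length*bound []         = z≤n
sum≤length*bound (e≤u ∷ es) = +-mono-≤ e≤u (sum≤length*bound es)

sum≡1⇒1∈ : ∀ (es : List ℕ) → sum es ≡ 1 → 1 ∈ es
sum≡1⇒1∈ (0 ∷ es)           s≡1 = there (sum≡1⇒1∈ es s≡1)
sum≡1⇒1∈ (1 ∷ es)           _   = here refl
sum≡1⇒1∈ (suc (suc _) ∷ _)  ()

-- e is an admissible excess for p when p + 2e is a prime of I_{2/m}(p);
-- the upper end p + 2p/m of the interval becomes the bound m e ≤ p.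
Excess : ℕ → ℕ → ℕ → Set
Excess m p e = Prime (p + 2 * e) × m * e ≤ p

private
  scaleExcess : ∀ m p e → m * p + 2 * (m * e) ≡ m * (p + 2 * e)
  scaleExcess = solve-∀

  addSummand : ∀ p e k S → p + 2 * e + (k * p + 2 * S) ≡ (1 + k) * p + 2 * (e + S)
  addSummand = solve-∀

excessOf : ∀ {m p q} → Odd p → 2 < p → InI 2 m p q → ∃[ e ] (q ≡ p + 2 * e × Excess m p e)
excessOf {m} {p} oddp 2<p (prq , p≤q , mq≤top)
  with oddGap oddp (oddPrime prq (<-≤-trans 2<p p≤q)) p≤q
... | e , refl = e , refl , prq , *-cancelˡ-≤ 2 (+-cancelˡ-≤ (m * p) _ _ 2me≤2p)
  where
  2me≤2p : m * p + 2 * (m * e) ≤ m * p + 2 * p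
  2me≤2p = ≤-trans (≤-reflexive (scaleExcess m p e)) mq≤top

excessDecomposition : ∀ {m p n} → Odd p → 2 < p → Representable 2 m p n →
  ∃[ es ] (All (Excess m p) es × n ≡ length es * p + 2 * sum es)
excessDecomposition oddp 2<p ([] , [] , refl) = [] , [] , refl
excessDecomposition {m} {p} oddp 2<p (q ∷ qs , q∈I ∷ qs∈I , refl)
  with excessOf {m} oddp 2<p q∈I | excessDecomposition {m} oddp 2<p (qs , qs∈I , refl)
... | e , refl , admissible | es , allAdmissible , sum≡ =
  e ∷ es , admissible ∷ allAdmissible , regroup sum≡
  where
  regroup : ∀ {s} → s ≡ length es * p + 2 * sum es →
            p + 2 * e + s ≡ (1 + length es) * p + 2 * (e + sum es)
  regroup refl = addSummand p e (length es) (sum es)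

-- The largest excess M of a decomposition is itself admissible (the
-- excess 0 of p itself serves as the base case) and S ≤ k M.
largestExcess : ∀ {m p} {es : List ℕ} → Prime p → All (Excess m p) es →
  ∃[ M ] (Excess m p M × sum es ≤ length es * M)
largestExcess {m} {p} {es} prp allAdmissible =
  max 0 es , argmax-all id excessZero allAdmissible , sum≤length*bound (xs≤max 0 es)
  where
  excessZero : Excess m p 0
  excessZero = subst Prime (sym (+-identityʳ p)) prp , subst (_≤ p) (sym (*-zeroʳ m)) z≤n

totalExcessBound : ∀ {m p} {es : List ℕ} → Prime p → All (Excess m p) es →
  m * sum es ≤ length es * p
totalExcessBound {m} {p} {es} prp allAdmissible
  with largestExcess {m} prp allAdmissible
... | M , (_ , mM≤p) , S≤kM = begin
  m * sum es          ≤⟨ *-monoʳ-≤ m S≤kM ⟩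
  m * (length es * M) ≡⟨ swap m (length es) M ⟩
  length es * (m * M) ≤⟨ *-monoʳ-≤ (length es) mM≤p ⟩
  length es * p       ∎
  where
  open ≤-Reasoning
  swap : ∀ a b c → a * (b * c) ≡ b * (a * c)
  swap = solve-∀

excessBudget : ∀ {m p k S} → .{{NonZero m}} → k ≤ m → m * S ≤ k * p → S ≤ p
excessBudget {m} {p} k≤m mS≤kp = *-cancelˡ-≤ m (≤-trans mS≤kp (*-monoˡ-≤ p k≤m))

-- An excess 2 S + 2 ≤ 2 p + 2 cannot make up for three or more missing
-- summands of size at least p > 2.
deficitTooLarge : ∀ {p S} j → 2 < p → S ≤ p → (3 + j) * p ≤ 2 * S + 2 → ⊥
deficitTooLarge {p} {S} j 2<p S≤p deficit = <-irrefl refl (begin-strict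
  2 * S + 2    ≤⟨ +-monoˡ-≤ 2 (*-monoʳ-≤ 2 S≤p) ⟩
  2 * p + 2    <⟨ +-monoʳ-< (2 * p) 2<p ⟩
  2 * p + p    ≡⟨ +-comm (2 * p) p ⟩
  3 * p        ≤⟨ *-monoˡ-≤ p (m≤m+n 3 j) ⟩
  (3 + j) * p  ≤⟨ deficit ⟩
  2 * S + 2    ∎)
  where open ≤-Reasoning

private
  fewer : ∀ k j p → (suc (k + j) + 2) * p ≡ k * p + (3 + j) * p
  fewer = solve-∀
  target : ∀ m p → (m + 2) * p ≡ (m * p + p) + p
  target = solve-∀
  targetBelow : ∀ m p S → m * p + 2 * suc S ≡ m * p + 2 * S + 2
  targetBelow = solve-∀
  targetAbove : ∀ m p → (m + 2) * p + 2 ≡ m * p + 2 * suc p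
  targetAbove = solve-∀
  targetAbove′ : ∀ m p → (m + 2) * p + 2 ≡ (m * p + p) + (p + 2)
  targetAbove′ = solve-∀
  moreBelow : ∀ m j p S → suc (m + j) * p + 2 * S + 2 ≡ (m * p + p) + (j * p + 2 * (S + 1))
  moreBelow = solve-∀
  moreAbove : ∀ m j p S → suc (m + j) * p + 2 * S ≡ (m * p + p) + (j * p + 2 * S)
  moreAbove = solve-∀
  overshootBelow : ∀ p j S → p + suc (j * p + 2 * S + 1) ≡ suc j * p + 2 * (S + 1)
  overshootBelow = solve-∀
  overshootAbove : ∀ p j S → p + (p + (j * p + 2 * S)) ≡ suc (suc j) * p + 2 * S
  overshootAbove = solve-∀

-- (m + 2) p - 2 is a sum of exactly m primes from I_{2/m}(p), with total
-- excess p - 1: fewer summands leave a deficit, m + 1 summands give the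
-- wrong parity and more summands are too large.
countBelow : ∀ {m p k S} → .{{NonZero m}} → Odd p → 2 < p → m * S ≤ k * p →
  k * p + 2 * S + 2 ≡ (m + 2) * p → k ≡ m × suc S ≡ p
countBelow {m} {p} {k} {S} (h , p≡) 2<p mS≤kp sum≡ with compare k m
... | less k j = ⊥-elim (deficitTooLarge j 2<p S≤p (≤-reflexive (sym deficit)))
  where
  S≤p : S ≤ p
  S≤p = excessBudget (≤-trans (m≤m+n k j) (n≤1+n _)) mS≤kp
  deficit : 2 * S + 2 ≡ (3 + j) * p
  deficit = +-cancelˡ-≡ (k * p) _ _
    (trans (sym (+-assoc (k * p) (2 * S) 2)) (trans sum≡ (fewer k j p)))
... | equal m = refl , *-cancelˡ-≡ (suc S) p 2 (+-cancelˡ-≡ (m * p) _ _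
    (trans (targetBelow m p S) (trans sum≡ (*-distribʳ-+ p m 2))))
... | greater m j = ⊥-elim (noSurplus j (+-cancelˡ-≡ (m * p + p) _ _
    (trans (sym (moreBelow m j p S)) (trans sum≡ (target m p)))))
  where
  noSurplus : ∀ j → j * p + 2 * (S + 1) ≢ p
  noSurplus zero    e = even≢odd (S + 1) h (trans e p≡)
  noSurplus (suc j) e = m+1+n≢m p (trans (overshootBelow p j S) e)

-- (m + 2) p + 2 is a sum of primes from I_{2/m}(p) only with total excess
-- S = 1 (using m + 2 summands): fewer than m + 1 summands leave a deficit,
-- m + 1 summands give the wrong parity and more than m + 2 are too large.
countAbove : ∀ {m p k S} → .{{NonZero m}} → Odd p → 2 < p → m * S ≤ k * p →
  k * p + 2 * S ≡ (m + 2) * p + 2 → S ≡ 1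
countAbove {m} {p} {k} {S} (h , p≡) 2<p mS≤kp sum≡ with compare k m
... | less k j =
  ⊥-elim (deficitTooLarge j 2<p S≤p
    (≤-trans (m≤m+n _ 2) (≤-trans (≤-reflexive (sym excess)) (m≤m+n (2 * S) 2))))
  where
  S≤p : S ≤ p
  S≤p = excessBudget (≤-trans (m≤m+n k j) (n≤1+n _)) mS≤kp
  excess : 2 * S ≡ (3 + j) * p + 2
  excess = +-cancelˡ-≡ (k * p) _ _
    (trans sum≡ (trans (cong (_+ 2) (fewer k j p)) (+-assoc (k * p) _ 2)))
... | equal m = ⊥-elim (<-irrefl refl (subst (_≤ p) S≡1+p (excessBudget ≤-refl mS≤kp)))
  where
  S≡1+p : S ≡ suc p
  S≡1+p = *-cancelˡ-≡ S (suc p) 2 (+-cancelˡ-≡ (m * p) _ _ (trans sum≡ (targetAbove m p)))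
... | greater m j = surplus j (+-cancelˡ-≡ (m * p + p) _ _
    (trans (sym (moreAbove m j p S)) (trans sum≡ (targetAbove′ m p))))
  where
  surplus : ∀ j → j * p + 2 * S ≡ p + 2 → S ≡ 1
  surplus zero e = ⊥-elim (even≢odd S (suc h) (trans e p+2≡))
    where
    p+2≡ : p + 2 ≡ suc (2 * suc h)
    p+2≡ = trans (cong (_+ 2) p≡) (trans (+-comm (1 + 2 * h) 2) (cong suc (sym (*-suc 2 h))))
  surplus (suc zero) e = *-cancelˡ-≡ S 1 2 (+-cancelˡ-≡ p _ _
    (trans (cong (_+ 2 * S) (sym (*-identityˡ p))) e))
  surplus (suc (suc j)) e = ⊥-elim (<⇒≱ 2<p
    (≤-trans (m≤m+n p _) (≤-reflexive (+-cancelˡ-≡ p _ _ (trans (overshootAbove p j S) e)))))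

-- Part (a)

-- If (m + 2) p + 2 is a sum of primes from I_{2/m}(p), then its total
-- excess is 1, so p + 2 is one of the summands and hence prime.
upperNeighbourPrime : ∀ {m p n} → .{{NonZero m}} → Prime p → Odd p → 2 < p →
  Representable 2 m p n → n ≡ (m + 2) * p + 2 → Prime (p + 2)
upperNeighbourPrime {m} prp oddp 2<p rep n≡ with excessDecomposition {m} oddp 2<p rep
... | es , allAdmissible , n≡kp+2S =
  proj₁ (All.lookup allAdmissible (sum≡1⇒1∈ es S≡1))
  where
  S≡1 : sum es ≡ 1
  S≡1 = countAbove {m} {k = length es} oddp 2<p (totalExcessBound {m} prp allAdmissible)
                   (trans (sym n≡kp+2S) n≡)

-- If (m + 2) p - 2 is a sum of primes from I_{2/m}(p) and 1 < m < p, then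
-- the m summands have total excess p - 1, so the largest excess t satisfies
-- p - 1 ≤ m t ≤ p; as m ∤ p this gives p = 1 + t m, and p + 2t is prime.
lowerNeighbour : ∀ {m p n} → .{{NonZero m}} → 1 < m → m < p → Prime p → Odd p → 2 < p →
  Representable 2 m p n → n + 2 ≡ (m + 2) * p →
  ∃[ t ] (Prime (p + 2 * t) × p ≡ 1 + t * m)
lowerNeighbour {m} {p} 1<m m<p prp oddp 2<p rep n+2≡ with excessDecomposition {m} oddp 2<p rep
... | es , allAdmissible , n≡kp+2S
  with countBelow {m} {k = length es} oddp 2<p (totalExcessBound {m} prp allAdmissible)
                  (trans (cong (_+ 2) (sym n≡kp+2S)) n+2≡)
     | largestExcess {m} prp allAdmissible
... | k≡m , 1+S≡p | t , (prime[p+2t] , mt≤p) , S≤kt = t , prime[p+2t] , p≡1+tm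
  where
  p≤1+mt : p ≤ suc (m * t)
  p≤1+mt = subst₂ (λ a b → a ≤ suc (b * t)) 1+S≡p k≡m (s≤s S≤kt)
  p≡1+tm : p ≡ 1 + t * m
  p≡1+tm with m≤n⇒m<n∨m≡n mt≤p
  ... | inj₁ mt<p = trans (≤-antisym p≤1+mt mt<p) (cong suc (*-comm m t))
  ... | inj₂ mt≡p =
    ⊥-elim (noProperDivisor prp 1<m m<p (divides t (trans (sym mt≡p) (*-comm m t))))

private
  excessForm : ∀ t m → 1 + t * m + 2 * t ≡ 1 + t * (m + 2)
  excessForm = solve-∀

smallFrobenius⇒T : ∀ {m} → 2 ≤ m → (p : ℕ) → InD 2 m p → m < p →
  (F : ℕ) → IsFrobenius 2 m p F → F + 2 < (m + 2) * p →
  ∃[ t ] (InT m t × p ≡ 1 + t * m)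
smallFrobenius⇒T {m} 2≤m p (prp , _) m<p F (_ , aboveF) F+2<N =
  witness (lowerNeighbour 2≤m m<p prp oddp 2<p (aboveF n₀ F<n₀) n₀+2≡N)
  where
  instance
    m≢0 : NonZero m
    m≢0 = >-nonZero (<-≤-trans z<s 2≤m)
  2<p : 2 < p
  2<p = ≤-<-trans 2≤m m<p
  oddp : Odd p
  oddp = oddPrime prp 2<p
  -- the two targets (m + 2) p - 2 and (m + 2) p + 2 both exceed F
  n₀ : ℕ
  n₀ = (m + 2) * p ∸ 2
  n₀+2≡N : n₀ + 2 ≡ (m + 2) * p
  n₀+2≡N = m∸n+n≡m (≤-trans (m≤n+m 2 F) (<⇒≤ F+2<N))
  F<n₀ : F < n₀
  F<n₀ = +-cancelʳ-< 2 F n₀ (subst (F + 2 <_) (sym n₀+2≡N) F+2<N)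
  F<N+2 : F < (m + 2) * p + 2
  F<N+2 = <-≤-trans (<-trans (m<m+n F z<s) F+2<N) (m≤m+n _ 2)
  twin : Prime (p + 2)
  twin = upperNeighbourPrime prp oddp 2<p (aboveF _ F<N+2) refl
  witness : ∃[ t ] (Prime (p + 2 * t) × p ≡ 1 + t * m) → ∃[ t ] (InT m t × p ≡ 1 + t * m)
  witness (zero , _ , p≡1) = ⊥-elim (<⇒≱ 2<p (≤-trans (≤-reflexive p≡1) (n≤1+n 1)))
  witness (t@(suc _) , prime[p+2t] , p≡1+tm) =
    t , (s≤s z≤n , subst Prime p≡1+tm prp
               , subst Prime (trans (cong (_+ 2) p≡1+tm) (+-comm (1 + t * m) 2)) twin
               , subst Prime (trans (cong (_+ 2 * t) p≡1+tm) (excessForm t m)) prime[p+2t])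
      , p≡1+tm

-- Part (b)

-- If T(m) is bounded by B, then p = 1 + t m with t ∈ T(m) forces
-- p ≤ m + B m, so beyond that bound part (a) gives (m + 2) p ≤ f(p) + 2.
finiteT⇒largeFrobenius : ∀ {m} → 2 ≤ m → (∃[ B ] (∀ t → InT m t → t ≤ B)) →
  ∃[ P ] (∀ p → InD 2 m p → P < p → (F : ℕ) → IsFrobenius 2 m p F → (m + 2) * p ≤ F + 2)
finiteT⇒largeFrobenius {m} 2≤m (B , bounded) = m + B * m , largeFrobenius
  where
  largeFrobenius : ∀ p → InD 2 m p → m + B * m < p →
    (F : ℕ) → IsFrobenius 2 m p F → (m + 2) * p ≤ F + 2
  largeFrobenius p inD P<p F frob =
    ≮⇒≥ (λ small → notOfForm (smallFrobenius⇒T 2≤m p inD m<p F frob small))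
    where
    m<p : m < p
    m<p = ≤-<-trans (m≤m+n m (B * m)) P<p
    notOfForm : ¬ (∃[ t ] (InT m t × p ≡ 1 + t * m))
    notOfForm (t , inT , p≡1+tm) = <⇒≱ P<p (begin
      p          ≡⟨ p≡1+tm ⟩
      1 + t * m  ≤⟨ +-mono-≤ (≤-trans (s≤s z≤n) 2≤m) (*-monoˡ-≤ m (bounded t inT)) ⟩
      m + B * m  ∎)
      where open ≤-Reasoning

-- Part (c)

data Residue3 : ℕ → Set where
  rem0 : ∀ c → Residue3 (c * 3)
  rem1 : ∀ c → Residue3 (1 + c * 3)
  rem2 : ∀ c → Residue3 (2 + c * 3)

residue3 : ∀ n → Residue3 n
residue3 zero = rem0 0
residue3 (suc n) with residue3 n
... | rem0 c = rem1 c
... | rem1 c = rem2 c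
... | rem2 c = rem0 (suc c)

3∣prime⇒≡3 : ∀ {n} → Prime n → 3 ∣ n → n ≡ 3
3∣prime⇒≡3 pr 3∣n with prime⇒irreducible pr 3∣n
... | inj₁ ()
... | inj₂ 3≡n = sym 3≡n

-- For t ∈ T(m), 3 ∤ 3 + t m: otherwise 3 + t m = 3, and 1 + t m = 1 would
-- be prime.
T⇒3∤3+tm : ∀ {m t} → InT m t → ¬ 3 ∣ 3 + t * m
T⇒3∤3+tm {m} {t} (_ , prime[1+tm] , prime[3+tm] , _) 3∣3+tm =
  ¬prime[1] (subst Prime (cong suc tm≡0) prime[1+tm])
  where
  tm≡0 : t * m ≡ 0
  tm≡0 = +-cancelˡ-≡ 3 (t * m) 0 (3∣prime⇒≡3 prime[3+tm] 3∣3+tm)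

private
  multiple0 : ∀ t c → 3 + t * (c * 3) ≡ (1 + t * c) * 3
  multiple0 = solve-∀
  multiple2-0 : ∀ h c → 3 + h * 3 * (2 + c * 3) ≡ (1 + h * (2 + c * 3)) * 3
  multiple2-0 = solve-∀
  multiple2-1 : ∀ h c → 1 + (1 + h * 3) * (2 + c * 3) ≡ (1 + c + 2 * h + 3 * h * c) * 3
  multiple2-1 = solve-∀
  multiple2-2 : ∀ h c → 1 + (2 + h * 3) * (2 + c * 3 + 2) ≡ (3 + 2 * c + 4 * h + 3 * h * c) * 3
  multiple2-2 = solve-∀
  expand2-2 : ∀ h c → 1 + (2 + h * 3) * (2 + c * 3 + 2) ≡ 9 + (6 * c + 12 * h + 9 * h * c)
  expand2-2 = solve-∀

-- T(m) is empty when 3 ∣ m, since then 3 ∣ 3 + t m.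
T-empty-0mod3 : ∀ c t → ¬ InT (c * 3) t
T-empty-0mod3 c t inT = T⇒3∤3+tm inT (divides (1 + t * c) (multiple0 t c))

-- For m ≡ 2 (mod 3) and t ∈ T(m), the number 3 + t m, 1 + t m or
-- 1 + t (m + 2) is divisible by 3 according as t ≡ 0, 1 or 2 (mod 3), hence
-- equal to 3; only the middle case is possible, and it gives t m = 2.
T-2mod3 : ∀ c t → InT (2 + c * 3) t → t * (2 + c * 3) ≡ 2
T-2mod3 c t inT@(_ , prime[1+tm] , _ , prime[1+t[m+2]]) with residue3 t
... | rem0 h = ⊥-elim (T⇒3∤3+tm inT (divides (1 + h * (2 + c * 3)) (multiple2-0 h c)))
... | rem1 h = cong pred (3∣prime⇒≡3 prime[1+tm]
                 (divides (1 + c + 2 * h + 3 * h * c) (multiple2-1 h c)))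
... | rem2 h = contradiction (trans (sym (expand2-2 h c)) 1+t[m+2]≡3) λ ()
  where
  1+t[m+2]≡3 : 1 + (2 + h * 3) * (2 + c * 3 + 2) ≡ 3
  1+t[m+2]≡3 = 3∣prime⇒≡3 prime[1+t[m+2]]
                 (divides (3 + 2 * c + 4 * h + 3 * h * c) (multiple2-2 h c))

T[2]≡[1] : ∀ t → (InT 2 t → t ≡ 1) × (t ≡ 1 → InT 2 t)
T[2]≡[1] t = (λ inT → *-cancelʳ-≡ t 1 2 (T-2mod3 0 t inT))
           , λ { refl → s≤s z≤n , from-yes (prime? 3) , from-yes (prime? 5) , from-yes (prime? 5) }

-- T(m) = ∅ for m > 2 with m ≢ 1 (mod 3): for m ≡ 2 (mod 3) the forced
-- equation t m = 2 is impossible.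
T-empty : ∀ m → 2 < m → m % 3 ≢ 1 → ∀ t → ¬ InT m t
T-empty m 2<m m%3≢1 t inT with residue3 m
... | rem0 c = T-empty-0mod3 c t inT
... | rem1 c = m%3≢1 ([m+kn]%n≡m%n 1 c 3)
... | rem2 c = <⇒≱ 2<m (≤-trans (m≤n*m _ t {{>-nonZero (proj₁ inT)}}) (≤-reflexive (T-2mod3 c t inT)))

lemma2p5 : (m : ℕ) → 2 ≤ m →
    ((p : ℕ) → InD 2 m p → m < p → (F : ℕ) → IsFrobenius 2 m p F → F + 2 < (m + 2) * p →
      ∃[ t ] (InT m t × p ≡ 1 + t * m))
    × ((∃[ B ] (∀ t → InT m t → t ≤ B)) →
      ∃[ P ] (∀ p → InD 2 m p → P < p → (F : ℕ) → IsFrobenius 2 m p F → (m + 2) * p ≤ F + 2))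
    × ((∀ t → (InT 2 t → t ≡ 1) × (t ≡ 1 → InT 2 t))
      × (2 < m → m % 3 ≢ 1 → ∀ t → ¬ InT m t))
lemma2p5 m 2≤m =
  smallFrobenius⇒T 2≤m , finiteT⇒largeFrobenius 2≤m , T[2]≡[1] , T-empty m
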